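{- Let $T$ be a non-unary string with $m$ runs, let $5\le k\le\lceil\sqrt{m}\,\rceil$, let $x,y,z,D_k$ be as in the context, and let $i$ be a run index with $1\le i\le (k-4)\lfloor\sqrt{m}\rfloor$ such that $P_i$ is non-empty and $p=r(P_i)>1$. Write $P_i=aub^{e_1}$, and let $\Gamma$, $e_2$, $t$ and $F(t,j)$ be as in the context, assuming $\min\Gamma\le e_1$. Then for each integer $j$ with $1\le j\le\sqrt{m}$, the string $T[\mathrm{End}(i)..\mathrm{End}(y+j-1)]$ has a short border of RLE size $p$ if and only if $F(t,j)$ has a short border of RLE size $p$.
   Context: Let $R_1,\dots,R_m$ be the maximal character runs of $T$, with beginning positions $\mathrm{Beg}(\cdot)$, ending positions $\mathrm{End}(\cdot)$ and lengths (exponents) $\mathrm{Exp}(\cdot)$. The RLE size $r(w)$ of a string $w$ is its number of maximal runs. A border of $w$ is a non-empty string that is both a proper prefix and a proper suffix of $w$; a border is short if its RLE size is at most $\sqrt{m}$. $T$ is divided into $\lceil\sqrt{m}\,\rceil$ consecutive blocks $J_1,\dots,J_{\lceil\sqrt{m}\,\rceil}$ consisting of whole runs, with $J_k$ having exactly $\lfloor\sqrt{m}\rfloor$ runs for $k<\lceil\sqrt{m}\,\rceil$. Let $x$ be the index of the first run of $J_{k-1}$, and $y$ and $z$ the indices of the first and last runs of $J_k$; let $D_k=J_{k-1}J_k=T[\mathrm{Beg}(x)..\mathrm{End}(z)]$. $P_i$ is the longest prefix of $T[\mathrm{End}(i)..\mathrm{End}(z)]$ that occurs (as a factor) in $D_k$,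 and $p=r(P_i)$. When $p>1$, write $P_i=aub^{e_1}$ where $a=P_i[1]$ is a character, $b^{e_1}$ is the last run of $P_i$, and $u$ is the remaining string. $\Gamma$ is the set of exponents of the run of $b$'s immediately following occurrences of $au$ in $D_k$, i.e., the set of integers $\gamma$ such that some occurrence of $au$ in $D_k$ is immediately followed by exactly $\gamma$ copies of $b$ forming a maximal run. If $\min\Gamma\le e_1$, let $e_2=\max\{\gamma\in\Gamma:\gamma\le e_1\}$ and let $t$ be a run index such that an occurrence of $au$ in $D_k$ starts at position $\mathrm{End}(t)$ and is immediately followed by a maximal run $b^{e_2}$. For $1\le j\le\sqrt{m}$, $F(t,j)=T[\mathrm{End}(t)..\mathrm{End}(z)]\,\$\,T[\mathrm{Beg}(x)..\mathrm{End}(y+j-1)]$, where $\$$ is a character not occurring in $T$. -}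

module Defs where

open import Data.Nat using (ℕ; zero; suc; _+_; _*_; _∸_; _≤_; _<_; _≤ᵇ_; _≡ᵇ_)
open import Data.Nat.ListAction using (sum)
open import Data.Bool using (if_then_else_)
open import Data.List using (List; []; _∷_; _++_; [_]; length; take; drop; map; replicate; head)
open import Data.Maybe using (Maybe; just; nothing)
open import Data.Maybe.Properties using (≡-dec)
open import Data.Product using (_×_; _,_; ∃; ∃-syntax; proj₂)
open import Relation.Nullary using (¬_; yes; no)
open import Relation.Binary.Definitions using (DecidableEquality)
open import Relation.Binary.PropositionalEquality using (_≡_)

sqrtGo : ℕ → ℕ → ℕ
sqrtGo n zero    = zero
sqrtGo n (suc b) = if suc b * suc b ≤ᵇ n then suc b else sqrtGo n b

⌊√_⌋ : ℕ → ℕ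
⌊√ n ⌋ = sqrtGo n n

⌈√_⌉ : ℕ → ℕ
⌈√ n ⌉ = if ⌊√ n ⌋ * ⌊√ n ⌋ ≡ᵇ n then ⌊√ n ⌋ else suc ⌊√ n ⌋

-- Strings are lists; positions are 1-indexed.
-- w[a..b] (inclusive); empty when b < a.
substr : {A : Set} → List A → ℕ → ℕ → List A
substr w a b = take (suc b ∸ a) (drop (a ∸ 1) w)

OccursIn : {A : Set} → List A → List A → Set
OccursIn P D = ∃[ l ] ∃[ r ] D ≡ l ++ P ++ r

IsPrefix : {A : Set} → List A → List A → Set
IsPrefix P S = ∃[ v ] S ≡ P ++ v

IsSuffix : {A : Set} → List A → List A → Set
IsSuffix P S = ∃[ v ] S ≡ v ++ P

IsBorder : {A : Set} → List A → List A → Set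
IsBorder β w = ¬ (β ≡ []) × length β < length w × IsPrefix β w × IsSuffix β w

module _ {A : Set} (_≟_ : DecidableEquality A) where

  rle : List A → List (A × ℕ)
  rle [] = []
  rle (c ∷ w) with rle w
  ... | [] = (c , 1) ∷ []
  ... | (d , n) ∷ rs with c ≟ d
  ...   | yes _ = (d , suc n) ∷ rs
  ...   | no _  = (c , 1) ∷ (d , n) ∷ rs

  r : List A → ℕ
  r w = length (rle w)

module Setup {A : Set} (_≟_ : DecidableEquality A) (T : List A) where

  m : ℕ
  m = r _≟_ T

  End : ℕ → ℕ
  End i = sum (map proj₂ (take i (rle _≟_ T)))

  Beg : ℕ → ℕ
  Beg i = suc (End (i ∸ 1))

  s c : ℕ
  s = ⌊√ m ⌋
  c = ⌈√ m ⌉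

  -- block J_k consists of runs (k-1)s+1 .. ks  (k < c), resp. (c-1)s+1 .. m (k = c)
  -- x = first run of J_{k-1}; y, z = first / last run of J_k
  xIdx yIdx zIdx : ℕ → ℕ
  xIdx k = suc ((k ∸ 2) * s)
  yIdx k = suc ((k ∸ 1) * s)
  zIdx k = if suc k ≤ᵇ c then k * s else m

  D : ℕ → List A
  D k = substr T (Beg (xIdx k)) (End (zIdx k))

  IsLongestPrefixOcc : ℕ → ℕ → List A → Set
  IsLongestPrefixOcc k i P =
    IsPrefix P S × OccursIn P (D k)
      × (∀ Q → IsPrefix Q S → OccursIn Q (D k) → length Q ≤ length P)
    where S = substr T (End i) (End (zIdx k))

  OccFollowed : ℕ → List A → A → ℕ → List A → Set
  OccFollowed k w b γ l =
    1 ≤ γ × ∃[ rest ] (D k ≡ l ++ w ++ replicate γ b ++ rest × ¬ (head rest ≡ just b))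

  InΓ : ℕ → List A → A → ℕ → Set
  InΓ k w b γ = ∃[ l ] OccFollowed k w b γ l

  -- F(t,j) = T[End(t)..End(z)] $ T[Beg(x)..End(y+j-1)], with $ = nothing
  F : ℕ → ℕ → ℕ → List (Maybe A)
  F k t j = map just (substr T (End t) (End (zIdx k)))
            ++ [ nothing ] ++ map just (substr T (Beg (xIdx k)) (End (yIdx k + j ∸ 1)))

  -- w has a short border (RLE size ≤ √m) of RLE size p
  HasShortBorderOfSize : {B : Set} → DecidableEquality B → ℕ → List B → Set
  HasShortBorderOfSize eq p w = ∃[ β ] (IsBorder β w × r eq β ≡ p × p ≤ s)

{-# OPTIONS --safe #-}
-- A short border β of W = T[End(i)..End(y+j−1)] has at most √m runs, fewer than the s + j runs of
-- its suffix V = T[Beg(x)..End(y+j−1)]; so β is a suffix of V and occurs in D_k. Being also a prefix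
-- of T[End(i)..End(z)], it is a prefix of the longest such prefix P_i = a u b^e₁, and having as many
-- runs as P_i it is a u b^e with 1 ≤ e ≤ e₁. Since V ends at a run boundary of D_k, e ∈ Γ, hence
-- e ≤ e₂ and β is a prefix of T[End(t)..End(z)] = a u b^e₂ ⋯, i.e. a border of F(t,j).
-- Conversely, $ occurs once in F(t,j), so its borders are the strings that are prefixes of
-- T[End(t)..End(z)] and suffixes of V; one with p runs is a u b^e with e ≤ e₂ ≤ e₁, hence a prefix
-- of P_i and therefore of W.

module Submission where

open import Defs
open import Data.Nat using (ℕ; zero; suc; _+_; _*_; _∸_; _⊓_; _≤_; _<_; z≤n; s≤s; _≤ᵇ_)
open import Data.Nat.Properties
open import Data.Nat.ListAction using (sum)
open import Data.Nat.ListAction.Properties using (sum-++)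
open import Function using (_∘_)
open import Data.Bool using (true; false)
open import Data.List using (List; []; _∷_; _++_; [_]; replicate; length; take; drop; map; head)
open import Data.List.Properties
  using ( ∷-injective; ∷-injectiveʳ; ++-assoc; ++-identityʳ; ++-cancelʳ; map-++; drop-drop; take-[]
        ; length-++; length-map; length-take; length-drop; length-++-≤ʳ; length-replicate )
open import Data.Maybe using (Maybe; just; nothing)
open import Data.Maybe.Properties using (≡-dec; just-injective)
open import Data.Product using (_×_; _,_; ∃-syntax; proj₂)
open import Data.Sum using (_⊎_; inj₁; inj₂)
open import Data.Unit using (⊤; tt)
open import Function.Bundles using (_⇔_; mk⇔)
open import Relation.Nullary using (¬_; yes; no; contradiction)
open import Relation.Binary.Definitions using (DecidableEquality)
open import Relation.Binary.PropositionalEquality hiding ([_])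

module _ {A : Set} where

  levi : ∀ (xs ys zs ws : List A) → xs ++ ys ≡ zs ++ ws →
         (∃[ v ] zs ≡ xs ++ v × ys ≡ v ++ ws) ⊎ (∃[ v ] xs ≡ zs ++ v × ws ≡ v ++ ys)
  levi []       ys zs       ws eq = inj₁ (zs , refl , eq)
  levi (x ∷ xs) ys []       ws eq = inj₂ (x ∷ xs , refl , sym eq)
  levi (x ∷ xs) ys (z ∷ zs) ws eq with ∷-injective eq
  ... | refl , eq′ with levi xs ys zs ws eq′
  ...   | inj₁ (v , zs≡ , ys≡) = inj₁ (v , cong (x ∷_) zs≡ , ys≡)
  ...   | inj₂ (v , xs≡ , ws≡) = inj₂ (v , cong (x ∷_) xs≡ , ws≡)

  prefix-of-longer-prefix : ∀ {β P S : List A} → IsPrefix β S → IsPrefix P S →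
                            length β ≤ length P → IsPrefix β P
  prefix-of-longer-prefix {β} {P} (v , S≡β++v) (w , S≡P++w) |β|≤|P|
    with levi β v P w (trans (sym S≡β++v) S≡P++w)
  ... | inj₁ (x , P≡β++x , _) = x , P≡β++x
  ... | inj₂ ([] , β≡P++[] , _) =
    [] , trans (sym (++-identityʳ P)) (trans (sym β≡P++[]) (sym (++-identityʳ β)))
  ... | inj₂ (x ∷ xs , β≡P++x∷xs , _) =
    contradiction (subst (_≤ length P) (trans (cong length β≡P++x∷xs) (length-++ P)) |β|≤|P|)
                  (m+1+n≰m (length P))

  prefix-trans : ∀ {xs ys zs : List A} → IsPrefix xs ys → IsPrefix ys zs → IsPrefix xs zs
  prefix-trans {xs} (v , ys≡xs++v) (w , zs≡ys++w) = v ++ w , trans zs≡ys++w (trans (cong (_++ w) ys≡xs++v) (++-assoc xs v w))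

  ≢[]⇒length>0 : ∀ {xs : List A} → ¬ xs ≡ [] → 0 < length xs
  ≢[]⇒length>0 {[]}    xs≢[] = contradiction refl xs≢[]
  ≢[]⇒length>0 {_ ∷ _} _     = s≤s z≤n

  replicate-+ : ∀ m n (x : A) → replicate (m + n) x ≡ replicate m x ++ replicate n x
  replicate-+ zero    n x = refl
  replicate-+ (suc m) n x = cong (x ∷_) (replicate-+ m n x)

  prefix-of-longer-run : ∀ (w : List A) b {e f} rest → e ≤ f →
                         IsPrefix (w ++ replicate e b) (w ++ replicate f b ++ rest)
  prefix-of-longer-run w b {e} {f} rest e≤f = replicate (f ∸ e) b ++ rest , (begin
    w ++ replicate f b ++ rest                          ≡⟨ cong (λ n → w ++ replicate n b ++ rest) (m+[n∸m]≡n e≤f) ⟨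
    w ++ replicate (e + (f ∸ e)) b ++ rest              ≡⟨ cong (λ xs → w ++ xs ++ rest) (replicate-+ e (f ∸ e) b) ⟩
    w ++ (replicate e b ++ replicate (f ∸ e) b) ++ rest ≡⟨ cong (w ++_) (++-assoc (replicate e b) _ rest) ⟩
    w ++ replicate e b ++ replicate (f ∸ e) b ++ rest   ≡⟨ ++-assoc w (replicate e b) _ ⟨
    (w ++ replicate e b) ++ replicate (f ∸ e) b ++ rest ∎)
    where open ≡-Reasoning

  prefix-of-replicate-++ : ∀ {b : A} f {w v rest} → w ++ v ≡ replicate f b ++ rest → ¬ head rest ≡ just b →
                           (∃[ e ] e ≤ f × w ≡ replicate e b) ⊎
                           (∃[ c ] ∃[ γ ] ¬ c ≡ b × w ≡ replicate f b ++ c ∷ γ)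
  prefix-of-replicate-++ f       {[]}    _  _ = inj₁ (0 , z≤n , refl)
  prefix-of-replicate-++ zero    {c ∷ γ} refl rest≁b = inj₂ (c , γ , (λ c≡b → rest≁b (cong just c≡b)) , refl)
  prefix-of-replicate-++ (suc f) {c ∷ w} eq rest≁b with ∷-injective eq
  ... | refl , eq′ with prefix-of-replicate-++ f {w} eq′ rest≁b
  ...   | inj₁ (e , e≤f , refl)     = inj₁ (suc e , s≤s e≤f , refl)
  ...   | inj₂ (c′ , γ , c′≢b , refl) = inj₂ (c′ , γ , c′≢b , refl)

  take-+ : ∀ m n (xs : List A) → take (m + n) xs ≡ take m xs ++ take n (drop m xs)
  take-+ zero    n xs       = refl
  take-+ (suc m) n []       = sym (take-[] n)
  take-+ (suc m) n (x ∷ xs) = cong (x ∷_) (take-+ m n xs)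

  drop-take : ∀ m n (xs : List A) → drop m (take n xs) ≡ take (n ∸ m) (drop m xs)
  drop-take zero    n       xs       = refl
  drop-take (suc m) zero    xs       = sym (take-[] 0)
  drop-take (suc m) (suc n) []       = sym (take-[] (n ∸ m))
  drop-take (suc m) (suc n) (x ∷ xs) = drop-take m n xs

  -- substr w (suc a) b reduces to slice a b w.
  slice : ℕ → ℕ → List A → List A
  slice a b xs = take (b ∸ a) (drop a xs)

  slice-++ : ∀ {a b c} (xs : List A) → a ≤ b → b ≤ c → slice a c xs ≡ slice a b xs ++ slice b c xs
  slice-++ {a} {b} {c} xs a≤b b≤c = begin
    take (c ∸ a) (drop a xs)                                      ≡⟨ cong (λ n → take n (drop a xs)) c∸a≡ ⟩
    take ((b ∸ a) + (c ∸ b)) (drop a xs)                          ≡⟨ take-+ (b ∸ a) (c ∸ b) (drop a xs) ⟩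
    take (b ∸ a) (drop a xs) ++ take (c ∸ b) (drop (b ∸ a) (drop a xs))
      ≡⟨ cong (λ ys → take (b ∸ a) (drop a xs) ++ take (c ∸ b) ys)
              (trans (drop-drop a (b ∸ a) xs) (cong (λ n → drop n xs) (m+[n∸m]≡n a≤b))) ⟩
    take (b ∸ a) (drop a xs) ++ take (c ∸ b) (drop b xs)          ∎
    where
    open ≡-Reasoning
    c∸a≡ : c ∸ a ≡ (b ∸ a) + (c ∸ b)
    c∸a≡ = +-cancelˡ-≡ a _ _ (begin
      a + (c ∸ a)             ≡⟨ m+[n∸m]≡n (≤-trans a≤b b≤c) ⟩
      c                       ≡⟨ m+[n∸m]≡n b≤c ⟨
      b + (c ∸ b)             ≡⟨ cong (_+ (c ∸ b)) (m+[n∸m]≡n a≤b) ⟨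
      a + (b ∸ a) + (c ∸ b)   ≡⟨ +-assoc a _ _ ⟩
      a + ((b ∸ a) + (c ∸ b)) ∎)

  drop-slice : ∀ a b n (xs : List A) → drop n (slice a b xs) ≡ slice (a + n) b xs
  drop-slice a b n xs = trans (drop-take n (b ∸ a) (drop a xs)) (cong₂ take (∸-+-assoc b a n) (drop-drop a n xs))

  length-slice : ∀ {a b} (xs : List A) → b ≤ length xs → length (slice a b xs) ≡ b ∸ a
  length-slice {a} {b} xs b≤|xs| =
    trans (length-take (b ∸ a) (drop a xs))
          (trans (cong ((b ∸ a) ⊓_) (length-drop a xs)) (m≤n⇒m⊓n≡m (∸-monoˡ-≤ a b≤|xs|)))

  drop-length-++ : ∀ (xs : List A) {ys} → drop (length xs) (xs ++ ys) ≡ ys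
  drop-length-++ []       = refl
  drop-length-++ (x ∷ xs) = drop-length-++ xs

  substr-split : ∀ (w : List A) {a b c} → 1 ≤ a → a ≤ suc b → b ≤ c →
                 substr w a c ≡ substr w a b ++ substr w (suc b) c
  substr-split w {suc a} _ (s≤s a≤b) b≤c = slice-++ w a≤b b≤c

  substr-nonempty : ∀ (w : List A) {a b} → 1 ≤ a → a ≤ b → a ≤ length w → ¬ substr w a b ≡ []
  substr-nonempty w {suc a} {b} _ a<b a<|w| substr≡[] = <⇒≢ 0<|substr| (sym (cong length substr≡[]))
    where
    0<|substr| : 0 < length (substr w (suc a) b)
    0<|substr| = subst (0 <_) (sym (trans (length-take (b ∸ a) (drop a w)) (cong ((b ∸ a) ⊓_) (length-drop a w))))
                       (⊓-glb (m<n⇒0<n∸m a<b) (m<n⇒0<n∸m a<|w|))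

  lastOf : A → List A → A
  lastOf c []      = c
  lastOf c (d ∷ w) = lastOf d w

  lastOf-++-∷ : ∀ c (w : List A) d v → lastOf c (w ++ d ∷ v) ≡ lastOf d v
  lastOf-++-∷ c []      d v = refl
  lastOf-++-∷ c (x ∷ w) d v = lastOf-++-∷ x w d v

  lastOf-replicate : ∀ (c : A) n → lastOf c (replicate n c) ≡ c
  lastOf-replicate c zero    = refl
  lastOf-replicate c (suc n) = lastOf-replicate c n

  lastOf-++-replicate : ∀ c (w : List A) {b e} → 1 ≤ e → lastOf c (w ++ replicate e b) ≡ b
  lastOf-++-replicate c w {b} {suc e} _ = trans (lastOf-++-∷ c w b (replicate e b)) (lastOf-replicate b e)

  RunBoundary : List A → List A → Set
  RunBoundary []      ys = ⊤
  RunBoundary (c ∷ w) ys = ¬ head ys ≡ just (lastOf c w)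

  RunBoundary-++ : ∀ xs {d w ys} → RunBoundary (d ∷ w) ys → RunBoundary (xs ++ d ∷ w) ys
  RunBoundary-++ []       bd = bd
  RunBoundary-++ (x ∷ xs) {d} {w} {ys} bd = subst (λ c → ¬ head ys ≡ just c) (sym (lastOf-++-∷ x xs d w)) bd

  RunBoundary-run : ∀ xs {ys b e} → 1 ≤ e → RunBoundary (xs ++ replicate e b) ys → ¬ head ys ≡ just b
  RunBoundary-run []       {ys} {b} {suc e} _ bd = subst (λ c → ¬ head ys ≡ just c) (lastOf-replicate b e) bd
  RunBoundary-run (x ∷ xs) {ys} 1≤e bd = subst (λ c → ¬ head ys ≡ just c) (lastOf-++-replicate x xs 1≤e) bd

-- Run-length encoding

module _ {A : Set} where

  decode : List (A × ℕ) → List A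
  decode []            = []
  decode ((c , n) ∷ R) = replicate n c ++ decode R

  FirstRunNot : A → List (A × ℕ) → Set
  FirstRunNot c []            = ⊤
  FirstRunNot c ((d , _) ∷ _) = ¬ c ≡ d

  -- The image of rle (Canonical-rle, rle-decode).
  Canonical : List (A × ℕ) → Set
  Canonical []            = ⊤
  Canonical ((c , n) ∷ R) = 1 ≤ n × FirstRunNot c R × Canonical R

  -- Setup.End is runEnd (rle T).
  runEnd : List (A × ℕ) → ℕ → ℕ
  runEnd R n = sum (map proj₂ (take n R))

  decode-++ : ∀ R R′ → decode (R ++ R′) ≡ decode R ++ decode R′
  decode-++ []            R′ = refl
  decode-++ ((c , n) ∷ R) R′ = trans (cong (replicate n c ++_) (decode-++ R R′)) (sym (++-assoc (replicate n c) _ _))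

  head-decode : ∀ {c} R → Canonical R → FirstRunNot c R → ¬ head (decode R) ≡ just c
  head-decode []                  _       _   ()
  head-decode ((d , suc _) ∷ _)   _       c≢d eq = c≢d (sym (just-injective eq))

  decode-boundary : ∀ R {R′} → Canonical (R ++ R′) → RunBoundary (decode R) (decode R′)
  decode-boundary []                              _ = tt
  decode-boundary ((c , suc f) ∷ []) {R′} (_ , c∉R′ , canonical-R′) last≡c =
    head-decode R′ canonical-R′ c∉R′
      (trans last≡c (cong just (trans (cong (lastOf c) (++-identityʳ (replicate f c))) (lastOf-replicate c f))))
  decode-boundary ((c , suc f) ∷ (d , suc g) ∷ R) (_ , _ , canonical) =
    RunBoundary-++ (replicate (suc f) c) (decode-boundary ((d , suc g) ∷ R) canonical)

  FirstRunNot-take : ∀ {c} n R → FirstRunNot c R → FirstRunNot c (take n R)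
  FirstRunNot-take zero    R       _   = tt
  FirstRunNot-take (suc n) []      _   = tt
  FirstRunNot-take (suc n) (_ ∷ _) c∉R = c∉R

  Canonical-take : ∀ n R → Canonical R → Canonical (take n R)
  Canonical-take zero    R             _                 = tt
  Canonical-take (suc n) []            _                 = tt
  Canonical-take (suc n) ((c , _) ∷ R) (1≤f , c∉R , can) = 1≤f , FirstRunNot-take n R c∉R , Canonical-take n R can

  Canonical-drop : ∀ n R → Canonical R → Canonical (drop n R)
  Canonical-drop zero    R       can           = can
  Canonical-drop (suc n) []      _             = tt
  Canonical-drop (suc n) (_ ∷ R) (_ , _ , can) = Canonical-drop n R can

  Canonical-slice : ∀ a b R → Canonical R → Canonical (slice a b R)
  Canonical-slice a b R can = Canonical-take (b ∸ a) (drop a R) (Canonical-drop a R can)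

  runEnd-+ : ∀ R m n → runEnd R (m + n) ≡ runEnd R m + runEnd (drop m R) n
  runEnd-+ R m n = begin
    sum (map proj₂ (take (m + n) R))                                  ≡⟨ cong (sum ∘ map proj₂) (take-+ m n R) ⟩
    sum (map proj₂ (take m R ++ take n (drop m R)))                   ≡⟨ cong sum (map-++ proj₂ (take m R) _) ⟩
    sum (map proj₂ (take m R) ++ map proj₂ (take n (drop m R)))       ≡⟨ sum-++ (map proj₂ (take m R)) _ ⟩
    runEnd R m + runEnd (drop m R) n                                  ∎
    where open ≡-Reasoning

  runEnd-mono : ∀ R {m n} → m ≤ n → runEnd R m ≤ runEnd R n
  runEnd-mono R {m} m≤n with m≤n⇒∃[o]m+o≡n m≤n
  ... | o , refl = subst (runEnd R m ≤_) (sym (runEnd-+ R m o)) (m≤m+n _ _)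

  runEnd-pos : ∀ R {n} → Canonical R → 1 ≤ n → n ≤ length R → 1 ≤ runEnd R n
  runEnd-pos ((c , f) ∷ R) {suc n} (1≤f , _) _ _ = ≤-trans 1≤f (m≤m+n f _)

  runEnd≤length : ∀ R n → runEnd R n ≤ length (decode R)
  runEnd≤length R             zero    = z≤n
  runEnd≤length []            (suc n) = z≤n
  runEnd≤length ((c , f) ∷ R) (suc n) =
    subst (f + runEnd R n ≤_) (sym (trans (length-++ (replicate f c)) (cong (_+ length (decode R)) (length-replicate f))))
          (+-monoʳ-≤ f (runEnd≤length R n))

  take-replicate-++ : ∀ f (c : A) n xs → take (f + n) (replicate f c ++ xs) ≡ replicate f c ++ take n xs
  take-replicate-++ zero    c n xs = refl
  take-replicate-++ (suc f) c n xs = cong (c ∷_) (take-replicate-++ f c n xs)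

  drop-replicate-++ : ∀ f (c : A) n xs → drop (f + n) (replicate f c ++ xs) ≡ drop n xs
  drop-replicate-++ zero    c n xs = refl
  drop-replicate-++ (suc f) c n xs = drop-replicate-++ f c n xs

  take-decode : ∀ R n → take (runEnd R n) (decode R) ≡ decode (take n R)
  take-decode R             zero    = refl
  take-decode []            (suc n) = take-[] 0
  take-decode ((c , f) ∷ R) (suc n) =
    trans (take-replicate-++ f c (runEnd R n) (decode R)) (cong (replicate f c ++_) (take-decode R n))

  drop-decode : ∀ R n → drop (runEnd R n) (decode R) ≡ decode (drop n R)
  drop-decode R             zero    = refl
  drop-decode []            (suc n) = refl
  drop-decode ((c , f) ∷ R) (suc n) = trans (drop-replicate-++ f c (runEnd R n) (decode R)) (drop-decode R n)

  slice-decode : ∀ R {a b} → a ≤ b → slice (runEnd R a) (runEnd R b) (decode R) ≡ decode (slice a b R)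
  slice-decode R {a} a≤b with m≤n⇒∃[o]m+o≡n a≤b
  ... | d , refl = begin
    take (runEnd R (a + d) ∸ runEnd R a) (drop (runEnd R a) (decode R))
      ≡⟨ cong₂ take (trans (cong (_∸ runEnd R a) (runEnd-+ R a d)) (m+n∸m≡n (runEnd R a) _)) (drop-decode R a) ⟩
    take (runEnd (drop a R) d) (decode (drop a R))   ≡⟨ take-decode (drop a R) d ⟩
    decode (take d (drop a R))                       ≡⟨ cong (λ n → decode (take n (drop a R))) (m+n∸m≡n a d) ⟨
    decode (take (a + d ∸ a) (drop a R))             ∎
    where open ≡-Reasoning

module RunLengthEncoding {A : Set} (_≟_ : DecidableEquality A) where

  consRun : A → List (A × ℕ) → List (A × ℕ)
  consRun c []             = (c , 1) ∷ []
  consRun c ((d , n) ∷ rs) with c ≟ d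
  ... | yes _ = (d , suc n) ∷ rs
  ... | no _  = (c , 1) ∷ (d , n) ∷ rs

  rle-∷ : ∀ c w → rle _≟_ (c ∷ w) ≡ consRun c (rle _≟_ w)
  rle-∷ c w with rle _≟_ w
  ... | []           = refl
  ... | (d , n) ∷ rs with c ≟ d
  ...   | yes _ = refl
  ...   | no _  = refl

  decode-consRun : ∀ c R → decode (consRun c R) ≡ c ∷ decode R
  decode-consRun c []            = refl
  decode-consRun c ((d , n) ∷ R) with c ≟ d
  ... | yes refl = refl
  ... | no _     = refl

  decode-rle : ∀ w → decode (rle _≟_ w) ≡ w
  decode-rle []      = refl
  decode-rle (c ∷ w) = trans (cong decode (rle-∷ c w)) (trans (decode-consRun c (rle _≟_ w)) (cong (c ∷_) (decode-rle w)))

  Canonical-consRun : ∀ c R → Canonical R → Canonical (consRun c R)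
  Canonical-consRun c []            _                 = s≤s z≤n , tt , tt
  Canonical-consRun c ((d , n) ∷ R) can@(_ , d∉R , canonical-R) with c ≟ d
  ... | yes _ = s≤s z≤n , d∉R , canonical-R
  ... | no c≢d = s≤s z≤n , c≢d , can

  Canonical-rle : ∀ w → Canonical (rle _≟_ w)
  Canonical-rle []      = tt
  Canonical-rle (c ∷ w) = subst Canonical (sym (rle-∷ c w)) (Canonical-consRun c (rle _≟_ w) (Canonical-rle w))

  consRun-fresh : ∀ {c} R → FirstRunNot c R → consRun c R ≡ (c , 1) ∷ R
  consRun-fresh []            _ = refl
  consRun-fresh {c} ((d , n) ∷ R) c≢d with c ≟ d
  ... | yes c≡d = contradiction c≡d c≢d
  ... | no _    = refl

  consRun-same : ∀ c n R → consRun c ((c , n) ∷ R) ≡ (c , suc n) ∷ R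
  consRun-same c n R with c ≟ c
  ... | yes _   = refl
  ... | no c≢c = contradiction refl c≢c

  rle-replicate-++ : ∀ c f R → FirstRunNot c R → rle _≟_ (decode R) ≡ R →
                     rle _≟_ (replicate (suc f) c ++ decode R) ≡ (c , suc f) ∷ R
  rle-replicate-++ c zero    R c∉R rle≡R =
    trans (rle-∷ c (decode R)) (trans (cong (consRun c) rle≡R) (consRun-fresh R c∉R))
  rle-replicate-++ c (suc f) R c∉R rle≡R =
    trans (rle-∷ c (replicate (suc f) c ++ decode R))
          (trans (cong (consRun c) (rle-replicate-++ c f R c∉R rle≡R)) (consRun-same c (suc f) R))

  rle-decode : ∀ R → Canonical R → rle _≟_ (decode R) ≡ R
  rle-decode []                  _                     = refl
  rle-decode ((c , suc f) ∷ R)   (_ , c∉R , canonical) = rle-replicate-++ c f R c∉R (rle-decode R canonical)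

  r-decode : ∀ R → Canonical R → r _≟_ (decode R) ≡ length R
  r-decode R can = cong length (rle-decode R can)

  last-run-boundary : ∀ {P rs a u b e} → rle _≟_ P ≡ rs ++ [ (b , e) ] → P ≡ a ∷ u ++ replicate e b → 1 ≤ e →
                      ¬ lastOf a u ≡ b
  last-run-boundary {P} {rs} {a} {u} {b} {suc e} rle≡ P≡ _ last≡b =
    subst (λ w → RunBoundary w (replicate (suc e) b ++ [])) decode-rs≡a∷u
          (decode-boundary rs (subst Canonical rle≡ (Canonical-rle P)))
          (cong just (sym last≡b))
    where
    decode-rs≡a∷u : decode rs ≡ a ∷ u
    decode-rs≡a∷u = ++-cancelʳ (replicate (suc e) b) (decode rs) (a ∷ u) (begin
      decode rs ++ replicate (suc e) b         ≡⟨ cong (decode rs ++_) (++-identityʳ _) ⟨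
      decode rs ++ replicate (suc e) b ++ []   ≡⟨ decode-++ rs _ ⟨
      decode (rs ++ [ (b , suc e) ])           ≡⟨ cong decode rle≡ ⟨
      decode (rle _≟_ P)                       ≡⟨ decode-rle P ⟩
      P                                        ≡⟨ P≡ ⟩
      a ∷ u ++ replicate (suc e) b             ∎)
      where open ≡-Reasoning

-- Counting runs

module RunCount {A : Set} (_≟_ : DecidableEquality A) where

  open RunLengthEncoding _≟_ using (rle-∷)

  changes : A → List A → ℕ
  changes c []      = 0
  changes c (d ∷ w) with c ≟ d
  ... | yes _ = changes d w
  ... | no _  = suc (changes d w)

  rle-∷-shape : ∀ c w → ∃[ n ] ∃[ rs ] rle _≟_ (c ∷ w) ≡ (c , n) ∷ rs × length rs ≡ changes c w
  rle-∷-shape c []      = 1 , [] , refl , refl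
  rle-∷-shape c (d ∷ w) with rle-∷-shape d w
  ... | n , rs , rle≡ , |rs|≡ rewrite rle-∷ c (d ∷ w) | rle≡ with c ≟ d
  ...   | yes refl = suc n , rs , refl , |rs|≡
  ...   | no _     = 1 , (d , n) ∷ rs , refl , cong suc |rs|≡

  r-∷ : ∀ c w → r _≟_ (c ∷ w) ≡ suc (changes c w)
  r-∷ c w with rle-∷-shape c w
  ... | _ , _ , rle≡ , |rs|≡ = trans (cong length rle≡) (cong suc |rs|≡)

  changes-++ : ∀ c w v → changes c (w ++ v) ≡ changes c w + changes (lastOf c w) v
  changes-++ c []      v = refl
  changes-++ c (d ∷ w) v with c ≟ d
  ... | yes _ = changes-++ d w v
  ... | no _  = cong suc (changes-++ d w v)

  changes-replicate : ∀ c n → changes c (replicate n c) ≡ 0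
  changes-replicate c zero    = refl
  changes-replicate c (suc n) with c ≟ c
  ... | yes _   = changes-replicate c n
  ... | no c≢c = contradiction refl c≢c

  changes-≢ : ∀ {c d} w → ¬ c ≡ d → changes c (d ∷ w) ≡ suc (changes d w)
  changes-≢ {c} {d} w c≢d with c ≟ d
  ... | yes c≡d = contradiction c≡d c≢d
  ... | no _    = refl

  changes-∷-≥ : ∀ c d w → changes d w ≤ changes c (d ∷ w)
  changes-∷-≥ c d w with c ≟ d
  ... | yes _ = ≤-refl
  ... | no _  = n≤1+n _

  r-++-≤ˡ : ∀ xs ys → r _≟_ xs ≤ r _≟_ (xs ++ ys)
  r-++-≤ˡ []      ys = z≤n
  r-++-≤ˡ (c ∷ w) ys = subst₂ _≤_ (sym (r-∷ c w)) (sym (r-∷ c (w ++ ys)))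
    (s≤s (subst (changes c w ≤_) (sym (changes-++ c w ys)) (m≤m+n _ _)))

  r-∷-≥ : ∀ c w → r _≟_ w ≤ r _≟_ (c ∷ w)
  r-∷-≥ c []      = z≤n
  r-∷-≥ c (d ∷ w) = subst₂ _≤_ (sym (r-∷ d w)) (sym (r-∷ c (d ∷ w))) (s≤s (changes-∷-≥ c d w))

  r-++-≤ʳ : ∀ xs ys → r _≟_ ys ≤ r _≟_ (xs ++ ys)
  r-++-≤ʳ []       ys = ≤-refl
  r-++-≤ʳ (x ∷ xs) ys = ≤-trans (r-++-≤ʳ xs ys) (r-∷-≥ x (xs ++ ys))

  r-new-run : ∀ a u {b e} → 1 ≤ e → ¬ lastOf a u ≡ b → r _≟_ (a ∷ u ++ replicate e b) ≡ suc (r _≟_ (a ∷ u))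
  r-new-run a u {b} {suc e} _ au≁b = begin
    r _≟_ (a ∷ u ++ b ∷ replicate e b)                            ≡⟨ r-∷ a (u ++ b ∷ replicate e b) ⟩
    suc (changes a (u ++ b ∷ replicate e b))                      ≡⟨ cong suc (changes-++ a u _) ⟩
    suc (changes a u + changes (lastOf a u) (b ∷ replicate e b))
      ≡⟨ cong (λ n → suc (changes a u + n)) (changes-≢ _ au≁b) ⟩
    suc (changes a u + suc (changes b (replicate e b)))
      ≡⟨ cong (λ n → suc (changes a u + suc n)) (changes-replicate b e) ⟩
    suc (changes a u + 1)                                         ≡⟨ cong suc (+-comm (changes a u) 1) ⟩
    suc (suc (changes a u))                                       ≡⟨ cong suc (r-∷ a u) ⟨
    suc (r _≟_ (a ∷ u))                                           ∎
    where open ≡-Reasoning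

  suffix-with-fewer-runs : ∀ {β xs ys} → IsSuffix β (xs ++ ys) → r _≟_ β < r _≟_ ys → IsSuffix β ys
  suffix-with-fewer-runs {β} {xs} {ys} (v , xs++ys≡v++β) rβ<rys with levi v β xs ys (sym xs++ys≡v++β)
  ... | inj₁ (w , _ , β≡w++ys) =
    contradiction (subst (λ z → r _≟_ ys ≤ r _≟_ z) (sym β≡w++ys) (r-++-≤ʳ w ys)) (<⇒≱ rβ<rys)
  ... | inj₂ (w , _ , ys≡w++β) = w , ys≡w++β

  prefix-with-one-more-run : ∀ {a u b} f {rest β} → ¬ lastOf a u ≡ b → 1 ≤ f → ¬ head rest ≡ just b →
                             IsPrefix β (a ∷ u ++ replicate f b ++ rest) → r _≟_ β ≡ suc (r _≟_ (a ∷ u)) →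
                             ∃[ e ] 1 ≤ e × e ≤ f × β ≡ a ∷ u ++ replicate e b
  prefix-with-one-more-run {a} {u} {b} f {rest} {β} au≁b 1≤f rest≁b (v , β⊑) rβ
    with levi β v (a ∷ u) (replicate f b ++ rest) (sym β⊑)
  ... | inj₁ (w , a∷u≡β++w , _) =
    contradiction (subst (_≤ r _≟_ (a ∷ u)) rβ
                         (subst (λ z → r _≟_ β ≤ r _≟_ z) (sym a∷u≡β++w) (r-++-≤ˡ β w)))
                  1+n≰n
  ... | inj₂ (w , refl , w++v≡) with prefix-of-replicate-++ f {w} (sym w++v≡) rest≁b
  ...   | inj₁ (zero , _ , refl)       = contradiction (trans (sym rβ) (cong (r _≟_) (++-identityʳ (a ∷ u)))) 1+n≢n
  ...   | inj₁ (suc e , e≤f , refl)    = suc e , s≤s z≤n , e≤f , refl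
  ...   | inj₂ (c , γ , c≢b , refl)    = contradiction rβ (>⇒≢ two-more-runs)
    where
    open ≤-Reasoning
    two-more-runs : suc (r _≟_ (a ∷ u)) < r _≟_ (a ∷ u ++ replicate f b ++ c ∷ γ)
    two-more-runs = begin-strict
      suc (r _≟_ (a ∷ u))                                 <⟨ n<1+n _ ⟩
      suc (suc (r _≟_ (a ∷ u)))                           ≡⟨ cong suc (r-new-run a u 1≤f au≁b) ⟨
      suc (r _≟_ (a ∷ u ++ replicate f b))
        ≡⟨ r-new-run a (u ++ replicate f b) (s≤s z≤n)
                     (λ last≡c → c≢b (trans (sym last≡c) (lastOf-++-replicate a u 1≤f))) ⟨
      r _≟_ (a ∷ (u ++ replicate f b) ++ [ c ])           ≤⟨ r-++-≤ˡ (a ∷ (u ++ replicate f b) ++ [ c ]) γ ⟩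
      r _≟_ ((a ∷ (u ++ replicate f b) ++ [ c ]) ++ γ)
        ≡⟨ cong (λ z → r _≟_ (a ∷ z))
                (trans (++-assoc (u ++ replicate f b) [ c ] γ) (++-assoc u (replicate f b) (c ∷ γ))) ⟩
      r _≟_ (a ∷ u ++ replicate f b ++ c ∷ γ)             ∎

module _ {A : Set} (_≟_ : DecidableEquality A) where

  private
    module Plain = RunCount _≟_
    module Lifted = RunCount (≡-dec _≟_)

  changes-map-just : ∀ c w → Lifted.changes (just c) (map just w) ≡ Plain.changes c w
  changes-map-just c []      = refl
  changes-map-just c (d ∷ w) with c ≟ d
  ... | yes _ = changes-map-just d w
  ... | no _  = cong suc (changes-map-just d w)

  r-map-just : ∀ w → r (≡-dec _≟_) (map just w) ≡ r _≟_ w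
  r-map-just []      = refl
  r-map-just (c ∷ w) =
    trans (Lifted.r-∷ (just c) (map just w)) (trans (cong suc (changes-map-just c w)) (sym (Plain.r-∷ c w)))

-- Borders of U $ V

module _ {A : Set} where

  separated : List A → List A → List (Maybe A)
  separated U V = map just U ++ [ nothing ] ++ map just V

  length-separated : ∀ U V → length (separated U V) ≡ length U + suc (length V)
  length-separated U V =
    trans (length-++ (map just U)) (cong₂ (λ m n → m + suc n) (length-map just U) (length-map just V))

  map-suffix⁻ : ∀ {B : Set} (f : A → B) xs ys β′ → map f xs ≡ ys ++ β′ →
                ∃[ β ] β′ ≡ map f β × IsSuffix β xs
  map-suffix⁻ f xs       []       β′ eq = xs , sym eq , [] , refl
  map-suffix⁻ f (x ∷ xs) (y ∷ ys) β′ eq with map-suffix⁻ f xs ys β′ (∷-injectiveʳ eq)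
  ... | β , β′≡ , (z , xs≡z++β) = β , β′≡ , x ∷ z , cong (x ∷_) xs≡z++β

  just-prefix⁻ : ∀ (β U : List A) {v ys} → map just β ++ v ≡ map just U ++ nothing ∷ ys → IsPrefix β U
  just-prefix⁻ []      U       _  = U , refl
  just-prefix⁻ (x ∷ β) (y ∷ U) eq with ∷-injective eq
  ... | x≡y , eq′ with just-prefix⁻ β U eq′
  ...   | w , U≡β++w = w , cong₂ _∷_ (sym (just-injective x≡y)) U≡β++w

  just-prefix-free : ∀ (U : List A) w {xs ys} → length w < length U → ¬ map just U ++ xs ≡ w ++ nothing ∷ ys
  just-prefix-free (x ∷ U) []      _         ()
  just-prefix-free (x ∷ U) (y ∷ w) (s≤s lt) eq = just-prefix-free U w lt (∷-injectiveʳ eq)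

  separated-border : ∀ {β U V : List A} → ¬ β ≡ [] → IsPrefix β U → IsSuffix β V →
                     IsBorder (map just β) (separated U V)
  separated-border {[]}    β≢[] _ _ = contradiction refl β≢[]
  separated-border {x ∷ β} {U} {V} _ (w , U≡x∷β++w) (z , V≡z++x∷β) = (λ ()) , shorter , prefix , suffix
    where
    shorter : length (map just (x ∷ β)) < length (separated U V)
    shorter = begin-strict
      length (map just (x ∷ β))   ≡⟨ length-map just (x ∷ β) ⟩
      length (x ∷ β)              ≤⟨ length-++-≤ʳ (x ∷ β) {z} ⟩
      length (z ++ x ∷ β)         ≡⟨ cong length V≡z++x∷β ⟨
      length V                    <⟨ s≤s (m≤n+m (length V) (length U)) ⟩
      suc (length U + length V)   ≡⟨ +-suc (length U) (length V) ⟨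
      length U + suc (length V)   ≡⟨ length-separated U V ⟨
      length (separated U V)      ∎
      where open ≤-Reasoning
    prefix : IsPrefix (map just (x ∷ β)) (separated U V)
    prefix = map just w ++ nothing ∷ map just V , (begin
      map just U ++ nothing ∷ map just V
        ≡⟨ cong (λ y → map just y ++ nothing ∷ map just V) U≡x∷β++w ⟩
      map just (x ∷ β ++ w) ++ nothing ∷ map just V
        ≡⟨ cong (_++ nothing ∷ map just V) (map-++ just (x ∷ β) w) ⟩
      (map just (x ∷ β) ++ map just w) ++ nothing ∷ map just V  ≡⟨ ++-assoc (map just (x ∷ β)) _ _ ⟩
      map just (x ∷ β) ++ map just w ++ nothing ∷ map just V    ∎)
      where open ≡-Reasoning
    suffix : IsSuffix (map just (x ∷ β)) (separated U V)
    suffix = map just U ++ nothing ∷ map just z , (begin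
      map just U ++ nothing ∷ map just V
        ≡⟨ cong (λ y → map just U ++ nothing ∷ map just y) V≡z++x∷β ⟩
      map just U ++ nothing ∷ map just (z ++ x ∷ β)
        ≡⟨ cong (λ y → map just U ++ nothing ∷ y) (map-++ just z (x ∷ β)) ⟩
      map just U ++ nothing ∷ map just z ++ map just (x ∷ β)    ≡⟨ ++-assoc (map just U) (nothing ∷ map just z) _ ⟨
      (map just U ++ nothing ∷ map just z) ++ map just (x ∷ β)  ∎)
      where open ≡-Reasoning

  separator-outside-border : ∀ {U V : List A} w → IsPrefix (w ++ nothing ∷ map just V) (separated U V) →
                             ¬ length (w ++ nothing ∷ map just V) < length (separated U V)
  separator-outside-border {U} {V} w (v , F≡) shorter =
    just-prefix-free U w |w|<|U| (trans F≡ (++-assoc w (nothing ∷ map just V) v))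
    where
    |w|<|U| : length w < length U
    |w|<|U| = +-cancelʳ-< (suc (length V)) (length w) (length U)
      (subst₂ _<_ (trans (length-++ w) (cong (λ n → length w + suc n) (length-map just V))) (length-separated U V) shorter)

  separated-border⁻¹ : ∀ {β′ : List (Maybe A)} {U V} → IsBorder β′ (separated U V) →
                       ∃[ β ] β′ ≡ map just β × ¬ β ≡ [] × IsPrefix β U × IsSuffix β V
  separated-border⁻¹ {β′} {U} {V} (β′≢[] , shorter , (v , F≡β′++v) , (v′ , F≡v′++β′))
    with levi v′ β′ (map just U) (nothing ∷ map just V) (sym F≡v′++β′)
  ... | inj₁ (w , _ , refl)  = contradiction shorter (separator-outside-border w (v , F≡β′++v))
  ... | inj₂ ([] , _ , refl) = contradiction shorter (separator-outside-border [] (v , F≡β′++v))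
  ... | inj₂ (_ ∷ w , _ , ∷≡) with map-suffix⁻ just V w β′ (∷-injectiveʳ ∷≡)
  ...   | β , refl , β⊒V = β , refl , (λ { refl → β′≢[] refl }) , just-prefix⁻ β U (sym F≡β′++v) , β⊒V

-- Transferring short borders

module _ {A : Set} where

  -- Setup.InΓ k w b γ is OccursFollowedByRun (D k) w b γ.
  OccursFollowedByRun : List A → List A → A → ℕ → Set
  OccursFollowedByRun D w b γ =
    ∃[ l ] (1 ≤ γ × ∃[ rest ] (D ≡ l ++ w ++ replicate γ b ++ rest × ¬ head rest ≡ just b))

-- In lemma8, W = T[End(i)..End(y+j−1)], V = T[Beg(x)..End(y+j−1)], S = T[End(i)..End(z)],
-- D = D_k and U = T[End(t)..End(z)].
module BorderTransfer {A : Set} (_≟_ : DecidableEquality A)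
  {W W₀ V S S₂ D R U P u rest : List A} {a b : A} {e₁ e₂ : ℕ}
  (W≡W₀++V : W ≡ W₀ ++ V) (W₀≢[] : ¬ W₀ ≡ []) (S≡W++S₂ : S ≡ W ++ S₂)
  (D≡V++R : D ≡ V ++ R) (V∣R : RunBoundary V R)
  (P⊑S : IsPrefix P S) (P-longest : ∀ Q → IsPrefix Q S → OccursIn Q D → length Q ≤ length P)
  (P≡ : P ≡ a ∷ u ++ replicate e₁ b) (au≁b : ¬ lastOf a u ≡ b)
  (U≡ : U ≡ a ∷ u ++ replicate e₂ b ++ rest) (rest≁b : ¬ head rest ≡ just b)
  (1≤e₂ : 1 ≤ e₂) (e₂≤e₁ : e₂ ≤ e₁)
  (e₂-max : ∀ γ → OccursFollowedByRun D (a ∷ u) b γ → γ ≤ e₁ → γ ≤ e₂)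
  where

  open RunCount _≟_

  1≤e₁ : 1 ≤ e₁
  1≤e₁ = ≤-trans 1≤e₂ e₂≤e₁

  r-P : r _≟_ P ≡ suc (r _≟_ (a ∷ u))
  r-P = trans (cong (r _≟_) P≡) (r-new-run a u 1≤e₁ au≁b)

  prefix-of-S : ∀ {β} → IsPrefix β W → IsPrefix β S
  prefix-of-S {β} (v , W≡β++v) = v ++ S₂ , trans S≡W++S₂ (trans (cong (_++ S₂) W≡β++v) (++-assoc β v S₂))

  border-prefix-of-P : ∀ {β} → IsPrefix β W → IsSuffix β V → IsPrefix β P
  border-prefix-of-P {β} β⊑W (z , V≡z++β) =
    prefix-of-longer-prefix (prefix-of-S β⊑W) P⊑S (P-longest β (prefix-of-S β⊑W) β-occurs)
    where
    β-occurs : OccursIn β D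
    β-occurs = z , R , trans D≡V++R (trans (cong (_++ R) V≡z++β) (++-assoc z β R))

  run-suffix-of-V-in-Γ : ∀ {e} → 1 ≤ e → IsSuffix (a ∷ u ++ replicate e b) V → OccursFollowedByRun D (a ∷ u) b e
  run-suffix-of-V-in-Γ {e} 1≤e (z , V≡) = z , 1≤e , R , D≡ , RunBoundary-run (z ++ a ∷ u) 1≤e V∣R′
    where
    V≡′ : V ≡ (z ++ a ∷ u) ++ replicate e b
    V≡′ = trans V≡ (sym (++-assoc z (a ∷ u) (replicate e b)))
    V∣R′ : RunBoundary ((z ++ a ∷ u) ++ replicate e b) R
    V∣R′ = subst (λ y → RunBoundary y R) V≡′ V∣R
    D≡ : D ≡ z ++ (a ∷ u) ++ replicate e b ++ R
    D≡ = trans D≡V++R (trans (cong (_++ R) V≡)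
                             (trans (++-assoc z _ R) (cong (λ y → z ++ a ∷ y) (++-assoc u (replicate e b) R))))

  border-of-W : ∀ {β} → ¬ β ≡ [] → IsPrefix β P → IsSuffix β V → IsBorder β W
  border-of-W {β} β≢[] β⊑P (z , V≡z++β) = β≢[] , shorter , β⊑W , β⊒W
    where
    shorter : length β < length W
    shorter = begin-strict
      length β               ≤⟨ length-++-≤ʳ β {z} ⟩
      length (z ++ β)        ≡⟨ cong length V≡z++β ⟨
      length V               <⟨ m<n+m (length V) (≢[]⇒length>0 W₀≢[]) ⟩
      length W₀ + length V   ≡⟨ trans (cong length W≡W₀++V) (length-++ W₀) ⟨
      length W               ∎
      where open ≤-Reasoning
    β⊑W : IsPrefix β W
    β⊑W = prefix-of-longer-prefix (prefix-trans β⊑P P⊑S) (S₂ , S≡W++S₂) (<⇒≤ shorter)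
    β⊒W : IsSuffix β W
    β⊒W = W₀ ++ z , trans W≡W₀++V (trans (cong (W₀ ++_) V≡z++β) (sym (++-assoc W₀ z β)))

  P≡++[] : P ≡ a ∷ u ++ replicate e₁ b ++ []
  P≡++[] = trans P≡ (cong (λ y → a ∷ u ++ y) (sym (++-identityʳ _)))

  border-to : ∀ {β} → r _≟_ β < r _≟_ V → IsBorder β W → r _≟_ β ≡ r _≟_ P →
              IsBorder (map just β) (separated U V)
  border-to {β} rβ<rV (β≢[] , _ , β⊑W , β⊒W) rβ≡rP
    with β⊒V ← suffix-with-fewer-runs (subst (IsSuffix β) W≡W₀++V β⊒W) rβ<rV
    with prefix-with-one-more-run {a} {u} {b} e₁ au≁b 1≤e₁ (λ ())
           (subst (IsPrefix β) P≡++[] (border-prefix-of-P β⊑W β⊒V)) (trans rβ≡rP r-P)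
  ... | e , 1≤e , e≤e₁ , refl =
    separated-border β≢[] (subst (IsPrefix _) (sym U≡) (prefix-of-longer-run (a ∷ u) b rest e≤e₂)) β⊒V
    where
    e≤e₂ : e ≤ e₂
    e≤e₂ = e₂-max e (run-suffix-of-V-in-Γ 1≤e β⊒V) e≤e₁

  border-from : ∀ {β′} → IsBorder β′ (separated U V) → r (≡-dec _≟_) β′ ≡ r _≟_ P →
                ∃[ β ] IsBorder β W × r _≟_ β ≡ r _≟_ P
  border-from β′-border rβ′≡rP with separated-border⁻¹ β′-border
  ... | β , refl , β≢[] , β⊑U , β⊒V
    with rβ≡rP ← trans (sym (r-map-just _≟_ β)) rβ′≡rP
    with prefix-with-one-more-run {a} {u} {b} e₂ au≁b 1≤e₂ rest≁b (subst (IsPrefix β) U≡ β⊑U) (trans rβ≡rP r-P)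
  ...   | e , _ , e≤e₂ , refl =
    _ , border-of-W β≢[] (subst (IsPrefix _) (sym P≡++[]) (prefix-of-longer-run (a ∷ u) b [] (≤-trans e≤e₂ e₂≤e₁))) β⊒V ,
    rβ≡rP

  transfer : ∀ s → s < r _≟_ V →
             (∃[ β ] (IsBorder β W × r _≟_ β ≡ r _≟_ P × r _≟_ P ≤ s)) ⇔
             (∃[ β ] (IsBorder β (separated U V) × r (≡-dec _≟_) β ≡ r _≟_ P × r _≟_ P ≤ s))
  transfer s s<rV = mk⇔ to from
    where
    to : ∃[ β ] (IsBorder β W × r _≟_ β ≡ r _≟_ P × r _≟_ P ≤ s) →
         ∃[ β ] (IsBorder β (separated U V) × r (≡-dec _≟_) β ≡ r _≟_ P × r _≟_ P ≤ s)
    to (β , β-border , rβ≡rP , rP≤s) =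
      map just β , border-to (≤-<-trans (≤-trans (≤-reflexive rβ≡rP) rP≤s) s<rV) β-border rβ≡rP ,
      trans (r-map-just _≟_ β) rβ≡rP , rP≤s
    from : ∃[ β ] (IsBorder β (separated U V) × r (≡-dec _≟_) β ≡ r _≟_ P × r _≟_ P ≤ s) →
           ∃[ β ] (IsBorder β W × r _≟_ β ≡ r _≟_ P × r _≟_ P ≤ s)
    from (β′ , β′-border , rβ′≡rP , rP≤s) with border-from β′-border rβ′≡rP
    ... | β , β-border , rβ≡rP = β , β-border , rβ≡rP , rP≤s

-- Blocks of runs of T

module Blocks {A : Set} (_≟_ : DecidableEquality A) (T : List A) where

  open Setup _≟_ T
  open RunLengthEncoding _≟_

  -- T[Beg(a+1)..End(b)], the concatenation of runs a+1, …, b.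
  runs : ℕ → ℕ → List A
  runs a b = slice (End a) (End b) T

  End-mono : ∀ {a b} → a ≤ b → End a ≤ End b
  End-mono = runEnd-mono (rle _≟_ T)

  End-pos : ∀ {i} → 1 ≤ i → i ≤ m → 1 ≤ End i
  End-pos = runEnd-pos (rle _≟_ T) (Canonical-rle T)

  End≤length : ∀ i → End i ≤ length T
  End≤length i = subst (End i ≤_) (cong length (decode-rle T)) (runEnd≤length (rle _≟_ T) i)

  runs≡decode : ∀ {a b} → a ≤ b → runs a b ≡ decode (slice a b (rle _≟_ T))
  runs≡decode {a} {b} a≤b =
    subst (λ w → slice (End a) (End b) w ≡ decode (slice a b (rle _≟_ T))) (decode-rle T) (slice-decode (rle _≟_ T) a≤b)

  r-runs : ∀ {a b} → a ≤ b → b ≤ m → r _≟_ (runs a b) ≡ b ∸ a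
  r-runs {a} {b} a≤b b≤m = begin
    r _≟_ (runs a b)                           ≡⟨ cong (r _≟_) (runs≡decode a≤b) ⟩
    r _≟_ (decode (slice a b (rle _≟_ T)))     ≡⟨ r-decode _ (Canonical-slice a b _ (Canonical-rle T)) ⟩
    length (slice a b (rle _≟_ T))             ≡⟨ length-slice {a = a} (rle _≟_ T) b≤m ⟩
    b ∸ a                                      ∎
    where open ≡-Reasoning

  runs-++ : ∀ {a b c} → a ≤ b → b ≤ c → runs a c ≡ runs a b ++ runs b c
  runs-++ a≤b b≤c = slice-++ T (End-mono a≤b) (End-mono b≤c)

  runs-boundary : ∀ {a b c} → a ≤ b → b ≤ c → RunBoundary (runs a b) (runs b c)
  runs-boundary {a} {b} {c} a≤b b≤c = subst₂ RunBoundary (sym (runs≡decode a≤b)) (sym (runs≡decode b≤c))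
    (decode-boundary (slice a b (rle _≟_ T))
      (subst Canonical (slice-++ (rle _≟_ T) a≤b b≤c) (Canonical-slice a c _ (Canonical-rle T))))

  substr-End-split : ∀ {i a b} → 1 ≤ i → i ≤ m → i ≤ a → a ≤ b →
                     substr T (End i) (End b) ≡ substr T (End i) (End a) ++ runs a b
  substr-End-split 1≤i i≤m i≤a a≤b =
    substr-split T (End-pos 1≤i i≤m) (≤-trans (End-mono i≤a) (n≤1+n _)) (End-mono a≤b)

  substr-End-nonempty : ∀ {i a} → 1 ≤ i → i ≤ m → i ≤ a → ¬ substr T (End i) (End a) ≡ []
  substr-End-nonempty {i} 1≤i i≤m i≤a = substr-nonempty T (End-pos 1≤i i≤m) (End-mono i≤a) (End≤length i)

  after-occurrence : ∀ {a b} l {Y} → runs a b ≡ l ++ Y → substr T (suc (End a) + length l) (End b) ≡ Y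
  after-occurrence {a} {b} l runs≡l++Y =
    trans (sym (drop-slice (End a) (End b) (length l) T)) (trans (cong (drop (length l)) runs≡l++Y) (drop-length-++ l))

  window-start≤end : ∀ k j → k * s ≤ suc k * s + j
  window-start≤end k j = ≤-trans (m≤n+m (k * s) s) (m≤m+n (s + k * s) j)

  r-window : ∀ k j → 1 ≤ j → suc k * s + j ≤ m → s < r _≟_ (runs (k * s) (suc k * s + j))
  r-window k j 1≤j end≤m =
    subst (s <_) (sym (trans (r-runs {k * s} (window-start≤end k j) end≤m) end∸start≡s+j)) (m<m+n s 1≤j)
    where
    open ≡-Reasoning
    end∸start≡s+j : suc k * s + j ∸ k * s ≡ s + j
    end∸start≡s+j = begin
      s + k * s + j ∸ k * s     ≡⟨ cong (_∸ k * s) (+-assoc s (k * s) j) ⟩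
      s + (k * s + j) ∸ k * s   ≡⟨ cong (λ n → s + n ∸ k * s) (+-comm (k * s) j) ⟩
      s + (j + k * s) ∸ k * s   ≡⟨ cong (_∸ k * s) (+-assoc s j (k * s)) ⟨
      s + j + k * s ∸ k * s     ≡⟨ m+n∸n≡m (s + j) (k * s) ⟩
      s + j                     ∎

  window≤zIdx : ∀ k j → j ≤ s → k * s + j ≤ m → k * s + j ≤ zIdx (suc k)
  window≤zIdx k j j≤s k*s+j≤m with suc (suc k) ≤ᵇ c
  ... | true  = ≤-trans (+-monoʳ-≤ (k * s) j≤s) (≤-reflexive (+-comm (k * s) s))
  ... | false = k*s+j≤m

lemma8 : {A : Set} (_≟_ : DecidableEquality A) (T : List A)
    → let open Setup _≟_ T in
    1 < m
    → (k : ℕ) → 5 ≤ k → k ≤ c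
    → (i : ℕ) → 1 ≤ i → i ≤ (k ∸ 4) * s
    → (P : List A) → IsLongestPrefixOcc k i P → ¬ (P ≡ [])
    → 1 < r _≟_ P
    → (a : A) (u : List A) (b : A) (e₁ : ℕ)
    → P ≡ a ∷ u ++ replicate e₁ b
    → (∃[ rs ] rle _≟_ P ≡ rs ++ [ (b , e₁) ])
    → (∃[ γ ] (InΓ k (a ∷ u) b γ × γ ≤ e₁))
    → (e₂ : ℕ) → InΓ k (a ∷ u) b e₂ → e₂ ≤ e₁
    → (∀ γ → InΓ k (a ∷ u) b γ → γ ≤ e₁ → γ ≤ e₂)
    → (t : ℕ) → 1 ≤ t → t ≤ m
    → (∃[ l ] (OccFollowed k (a ∷ u) b e₂ l × Beg (xIdx k) + length l ≡ End t))
    → (j : ℕ) → 1 ≤ j → j ≤ s → yIdx k + j ∸ 1 ≤ m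
    → HasShortBorderOfSize _≟_ (r _≟_ P) (substr T (End i) (End (yIdx k + j ∸ 1)))
    ⇔ HasShortBorderOfSize (≡-dec _≟_) (r _≟_ P) (F k t j)
lemma8 _≟_ T _ (suc (suc k)) (s≤s (s≤s _)) _ i 1≤i i≤[k∸2]s P (P⊑S , _ , P-longest) _ _ a u b e₁ P≡ (_ , rle-P≡) _
       e₂ _ e₂≤e₁ e₂-max t _ _ (l , (1≤e₂ , rest , D≡ , rest≁b) , Beg+l≡End-t) j 1≤j j≤s Q≤m =
  BorderTransfer.transfer _≟_ W≡W₀++V W₀≢[] S≡W++S₂ (runs-++ {X} X≤Q Q≤z) (runs-boundary {X} X≤Q Q≤z)
    P⊑S P-longest P≡ (last-run-boundary rle-P≡ P≡ (≤-trans 1≤e₂ e₂≤e₁)) U≡ rest≁b 1≤e₂ e₂≤e₁ e₂-max s s<rV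
  where
  -- k is the paper's k − 2, so that X = x − 1, Q = y + j − 1 and z is the last run of J_k.
  open Setup _≟_ T
  open Blocks _≟_ T
  open RunLengthEncoding _≟_ using (last-run-boundary)
  X Q z : ℕ
  X = k * s
  Q = suc k * s + j
  z = zIdx (suc (suc k))
  i≤X : i ≤ X
  i≤X = ≤-trans i≤[k∸2]s (*-monoˡ-≤ s (m∸n≤m k 2))
  X≤Q : X ≤ Q
  X≤Q = window-start≤end k j
  Q≤z : Q ≤ z
  Q≤z = window≤zIdx (suc k) j j≤s Q≤m
  i≤m : i ≤ m
  i≤m = ≤-trans i≤X (≤-trans X≤Q Q≤m)
  W≡W₀++V : substr T (End i) (End Q) ≡ substr T (End i) (End X) ++ runs X Q
  W≡W₀++V = substr-End-split {i} {X} 1≤i i≤m i≤X X≤Q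
  S≡W++S₂ : substr T (End i) (End z) ≡ substr T (End i) (End Q) ++ runs Q z
  S≡W++S₂ = substr-End-split {i} {Q} 1≤i i≤m (≤-trans i≤X X≤Q) Q≤z
  W₀≢[] : ¬ substr T (End i) (End X) ≡ []
  W₀≢[] = substr-End-nonempty {i} {X} 1≤i i≤m i≤X
  s<rV : s < r _≟_ (runs X Q)
  s<rV = r-window k j 1≤j Q≤m
  U≡ : substr T (End t) (End z) ≡ a ∷ u ++ replicate e₂ b ++ rest
  U≡ = subst (λ n → substr T n (End z) ≡ a ∷ u ++ replicate e₂ b ++ rest) Beg+l≡End-t (after-occurrence {X} {z} l D≡)
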